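{- The modal logic $\mathbf{GV}=\Gamma(\mathbf{LV},1,1)$ has the uniform Lyndon interpolation property (and hence the Lyndon interpolation property).
   Context: Modal formulas use variables, $\bot,\land,\lor,\neg,\to,\Box$. Positive/negative variables: $v^+(p)=\{p\}$, $v^-(p)=\emptyset$, $v^\circ(\bot)=\emptyset$, $\land,\lor,\Box$ preserve polarity, $v^\pm(\neg\varphi)=v^\mp(\varphi)$, $v^+(\varphi\to\psi)=v^-(\varphi)\cup v^+(\psi)$, $v^-(\varphi\to\psi)=v^+(\varphi)\cup v^-(\psi)$. $\mathbf{GV}$ is the set of modal formulas true at every world of every Kripke model on the frame $(W,R)$ with $W=\{r,a,b\}$ and $R$ the reflexive closure of $\{(r,a),(r,b)\}$ (a root below two distinct final points). A logic $L$ has the uniform Lyndon interpolation property iff for every formula $\varphi$ and finite sets $P^+,P^-$ of variables there is $\theta$ with $L\vdash\varphi\to\theta$, $v^\circ(\theta)\subseteq v^\circ(\varphi)\setminus P^\circ$ for $\circ\in\{+,-\}$, and $L\vdash\theta\to\psi$ for every $\psi$ with $L\vdash\varphi\to\psi$ and $v^\circ(\psi)\cap P^\circ=\emptyset$ for $\circ\in\{+,-\}$. $L$ has the Lyndon interpolation property iff whenever $L\vdash\varphi\to\psi$ there is $\rho$ with $v^\circ(\rho)\subseteq v^\circ(\varphi)\cap v^\circ(\psi)$ for $\circ\in\{+,-\}$, $L\vdash\varphi\to\rho$ and $L\vdash\rho\to\psi$. -}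

module Defs where

open import Data.Nat using (ℕ)
open import Data.Bool using (Bool; true; false; _∧_; _∨_; not)
open import Data.List using (List; []; [_]; _++_)
open import Data.List.Membership.Propositional using (_∈_; _∉_)
open import Data.Product using (_×_; Σ-syntax)
open import Relation.Binary.PropositionalEquality using (_≡_)

data Fm : Set where
  var  : ℕ → Fm
  ⊥'   : Fm
  _∧'_ : Fm → Fm → Fm
  _∨'_ : Fm → Fm → Fm
  ¬'_  : Fm → Fm
  _⇒_  : Fm → Fm → Fm
  □_   : Fm → Fm

mutual
  v⁺ : Fm → List ℕ
  v⁺ (var p) = [ p ]
  v⁺ ⊥' = []
  v⁺ (φ ∧' ψ) = v⁺ φ ++ v⁺ ψ
  v⁺ (φ ∨' ψ) = v⁺ φ ++ v⁺ ψ
  v⁺ (¬' φ) = v⁻ φ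
  v⁺ (φ ⇒ ψ) = v⁻ φ ++ v⁺ ψ
  v⁺ (□ φ) = v⁺ φ

  v⁻ : Fm → List ℕ
  v⁻ (var p) = []
  v⁻ ⊥' = []
  v⁻ (φ ∧' ψ) = v⁻ φ ++ v⁻ ψ
  v⁻ (φ ∨' ψ) = v⁻ φ ++ v⁻ ψ
  v⁻ (¬' φ) = v⁺ φ
  v⁻ (φ ⇒ ψ) = v⁺ φ ++ v⁻ ψ
  v⁻ (□ φ) = v⁻ φ

data W : Set where
  r a b : W

data R : W → W → Set where
  r-r : R r r
  r-a : R r a
  r-b : R r b
  a-a : R a a
  b-b : R b b

Valuation : Set
Valuation = ℕ → W → Bool

eval : Valuation → Fm → W → Bool
eval V (var p) w = V p w
eval V ⊥' w = false
eval V (φ ∧' ψ) w = eval V φ w ∧ eval V ψ w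
eval V (φ ∨' ψ) w = eval V φ w ∨ eval V ψ w
eval V (¬' φ) w = not (eval V φ w)
eval V (φ ⇒ ψ) w = not (eval V φ w) ∨ eval V ψ w
eval V (□ φ) r = eval V φ r ∧ eval V φ a ∧ eval V φ b
eval V (□ φ) a = eval V φ a
eval V (□ φ) b = eval V φ b

GV⊢ : Fm → Set
GV⊢ φ = (V : Valuation) (w : W) → eval V φ w ≡ true

Logic : Set₁
Logic = Fm → Set

UniformLyndon : Logic → Set
UniformLyndon L =
  (φ : Fm) (P⁺ P⁻ : List ℕ) →
  Σ[ θ ∈ Fm ]
    ( L (φ ⇒ θ)
    × ((p : ℕ) → p ∈ v⁺ θ → (p ∈ v⁺ φ × p ∉ P⁺))
    × ((p : ℕ) → p ∈ v⁻ θ → (p ∈ v⁻ φ × p ∉ P⁻))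
    × ((ψ : Fm) → L (φ ⇒ ψ) →
         ((p : ℕ) → p ∈ v⁺ ψ → p ∉ P⁺) →
         ((p : ℕ) → p ∈ v⁻ ψ → p ∉ P⁻) →
         L (θ ⇒ ψ)) )

Lyndon : Logic → Set
Lyndon L =
  (φ ψ : Fm) → L (φ ⇒ ψ) →
  Σ[ ρ ∈ Fm ]
    ( ((p : ℕ) → p ∈ v⁺ ρ → (p ∈ v⁺ φ × p ∈ v⁺ ψ))
    × ((p : ℕ) → p ∈ v⁻ ρ → (p ∈ v⁻ φ × p ∈ v⁻ ψ))
    × L (φ ⇒ ρ)
    × L (ρ ⇒ ψ) )

{-# OPTIONS --safe #-}
-- For a valuation U let χ U x be the conjunction of the literals of φ true at x in U, omitting
-- positive literals of variables in P⁺ and negative literals of variables in P⁻. On this frame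
-- one formula, diagram X, says that the current point is the image of the root under a
-- p-morphism sending each x to a point satisfying X x. The uniform interpolant θ is the
-- disjunction of diagram (χ U) over the finitely many valuations U of the variables of φ that
-- satisfy φ at the root.
-- φ entails θ: pull the model back along the p-morphism onto the cone of the current point.
-- θ entails every consequence ψ of φ avoiding P⁺, P⁻: if diagram (χ U) holds at w via k, a
-- valuation between U and V ∘ k (in the polarity-sensitive sense) still satisfies φ, hence ψ,
-- at the root, and ψ transfers along k to w.
-- Lyndon interpolation is the instance P± = v±(φ) ∖ v±(ψ).
module Submission where

open import Defs
open import Data.Bool using (Bool; true; false; _∧_; _∨_; not; T)
open import Data.Bool.Properties using (T-≡; T-∧; T-∨; T?)
open import Data.Empty using (⊥; ⊥-elim)
open import Data.List using (List; []; _∷_; [_]; _++_; filter; cartesianProductWith)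
open import Data.List.Membership.Propositional using (_∈_; _∉_)
open import Data.List.Membership.Propositional.Properties
  using (∈-++⁺ˡ; ∈-++⁺ʳ; ∈-filter⁺; ∈-filter⁻; ∈-cartesianProductWith⁺)
open import Data.List.Relation.Unary.All as All using (All; []; _∷_)
open import Data.List.Relation.Unary.All.Properties using (++⁺; ++⁻)
open import Data.List.Relation.Unary.Any using (here; there; tail)
open import Data.Nat using (ℕ; _≟_)
open import Data.List.Membership.DecPropositional _≟_ using (_∈?_; _∉?_)
open import Data.Product using (_×_; _,_; proj₁; proj₂; uncurry; ∃-syntax)
import Data.Product as Product
open import Data.Product.Function.NonDependent.Propositional using (_×-⇔_)
open import Data.Sum using (_⊎_; inj₁; inj₂)
import Data.Sum as Sum
open import Data.Sum.Function.Propositional using (_⊎-⇔_)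
open import Data.Unit using (tt)
open import Function using (_∘_; _$_; id; _⇔_; mk⇔; Equivalence)
open import Function.Construct.Composition using (_⇔-∘_)
open import Function.Related.TypeIsomorphisms using (¬-cong-⇔; →-cong-⇔)
open import Relation.Nullary using (¬_; Dec; yes; no)
open import Relation.Nullary.Decidable using (decidable-stable; _×-dec_; ¬?)
import Relation.Nullary.Decidable as Dec
open import Relation.Binary.PropositionalEquality using (_≡_; refl; sym; subst)

open Equivalence using (to; from)

infix 4 _⊨[_]_ _⊨_

_⊨[_]_ : Valuation → W → Fm → Set
V ⊨[ w ] var p  = T (V p w)
V ⊨[ w ] ⊥'     = ⊥
V ⊨[ w ] φ ∧' ψ = V ⊨[ w ] φ × V ⊨[ w ] ψ
V ⊨[ w ] φ ∨' ψ = V ⊨[ w ] φ ⊎ V ⊨[ w ] ψ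
V ⊨[ w ] ¬' φ   = ¬ V ⊨[ w ] φ
V ⊨[ w ] φ ⇒ ψ  = V ⊨[ w ] φ → V ⊨[ w ] ψ
V ⊨[ w ] □ φ    = ∀ {u} → R w u → V ⊨[ u ] φ

_⊨_ : Fm → Fm → Set
φ ⊨ ψ = ∀ V w → V ⊨[ w ] φ → V ⊨[ w ] ψ

T-not : ∀ {x} → T (not x) ⇔ (¬ T x)
T-not {true}  = mk⇔ (λ ()) (λ ¬t → ¬t tt)
T-not {false} = mk⇔ (λ _ ()) (λ _ → tt)

T-⇒ : ∀ {x y} → T (not x ∨ y) ⇔ (T x → T y)
T-⇒ {true}  = mk⇔ (λ ty _ → ty) (λ f → f tt)
T-⇒ {false} = mk⇔ (λ _ ()) (λ _ → tt)

□-r⇔ : ∀ {P : W → Set} → (P r × P a × P b) ⇔ (∀ {u} → R r u → P u)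
□-r⇔ = mk⇔ (λ { (pr , pa , pb) → λ { r-r → pr ; r-a → pa ; r-b → pb } })
            (λ h → h r-r , h r-a , h r-b)

□-a⇔ : ∀ {P : W → Set} → P a ⇔ (∀ {u} → R a u → P u)
□-a⇔ = mk⇔ (λ pa → λ { a-a → pa }) (λ h → h a-a)

□-b⇔ : ∀ {P : W → Set} → P b ⇔ (∀ {u} → R b u → P u)
□-b⇔ = mk⇔ (λ pb → λ { b-b → pb }) (λ h → h b-b)

T-eval⇔⊨ : ∀ V w φ → T (eval V φ w) ⇔ V ⊨[ w ] φ
T-eval⇔⊨ V w (var p)  = mk⇔ id id
T-eval⇔⊨ V w ⊥'       = mk⇔ id id
T-eval⇔⊨ V w (φ ∧' ψ) = (T-eval⇔⊨ V w φ ×-⇔ T-eval⇔⊨ V w ψ) ⇔-∘ T-∧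
T-eval⇔⊨ V w (φ ∨' ψ) = (T-eval⇔⊨ V w φ ⊎-⇔ T-eval⇔⊨ V w ψ) ⇔-∘ T-∨
T-eval⇔⊨ V w (¬' φ)   = ¬-cong-⇔ (T-eval⇔⊨ V w φ) ⇔-∘ T-not
T-eval⇔⊨ V w (φ ⇒ ψ)  = →-cong-⇔ (T-eval⇔⊨ V w φ) (T-eval⇔⊨ V w ψ) ⇔-∘ T-⇒
T-eval⇔⊨ V r (□ φ)    =
  □-r⇔ ⇔-∘ ((T-eval⇔⊨ V r φ ×-⇔ ((T-eval⇔⊨ V a φ ×-⇔ T-eval⇔⊨ V b φ) ⇔-∘ T-∧)) ⇔-∘ T-∧)
T-eval⇔⊨ V a (□ φ)    = □-a⇔ ⇔-∘ T-eval⇔⊨ V a φ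
T-eval⇔⊨ V b (□ φ)    = □-b⇔ ⇔-∘ T-eval⇔⊨ V b φ

⊨? : ∀ V w φ → Dec (V ⊨[ w ] φ)
⊨? V w φ = Dec.map (T-eval⇔⊨ V w φ) (T? (eval V φ w))

⊢⇔⊨ : ∀ {φ ψ} → GV⊢ (φ ⇒ ψ) ⇔ φ ⊨ ψ
⊢⇔⊨ {φ} {ψ} = mk⇔
  (λ ⊢φ⇒ψ V w → to (T-eval⇔⊨ V w (φ ⇒ ψ)) (from T-≡ (⊢φ⇒ψ V w)))
  (λ φ⊨ψ V w → to T-≡ (from (T-eval⇔⊨ V w (φ ⇒ ψ)) (φ⊨ψ V w)))

record IsPMorphism (k : W → W) : Set where
  field
    forth : ∀ {x y} → R x y → R (k x) (k y)
    back  : ∀ {x v} → R (k x) v → ∃[ y ] (R x y × k y ≡ v)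

Rises Falls : Valuation → Valuation → (W → W) → ℕ → Set
Rises V₁ V₂ k p = ∀ x → T (V₁ p x) → T (V₂ p (k x))
Falls V₁ V₂ k p = ∀ x → T (V₂ p (k x)) → T (V₁ p x)

module _ {V₁ V₂ : Valuation} {k : W → W} (pm : IsPMorphism k) where
  open IsPMorphism pm

  mutual
    preserve : ∀ ψ → All (Rises V₁ V₂ k) (v⁺ ψ) → All (Falls V₁ V₂ k) (v⁻ ψ) →
               ∀ x → V₁ ⊨[ x ] ψ → V₂ ⊨[ k x ] ψ
    preserve (var p) (rise ∷ []) _ x = rise x
    preserve ⊥' _ _ x ()
    preserve (ψ₁ ∧' ψ₂) rises falls x with ++⁻ (v⁺ ψ₁) rises | ++⁻ (v⁻ ψ₁) falls
    ... | rises₁ , rises₂ | falls₁ , falls₂ =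
      Product.map (preserve ψ₁ rises₁ falls₁ x) (preserve ψ₂ rises₂ falls₂ x)
    preserve (ψ₁ ∨' ψ₂) rises falls x with ++⁻ (v⁺ ψ₁) rises | ++⁻ (v⁻ ψ₁) falls
    ... | rises₁ , rises₂ | falls₁ , falls₂ =
      Sum.map (preserve ψ₁ rises₁ falls₁ x) (preserve ψ₂ rises₂ falls₂ x)
    preserve (¬' ψ) rises falls x ¬ψ = ¬ψ ∘ reflect ψ falls rises x
    preserve (ψ₁ ⇒ ψ₂) rises falls x with ++⁻ (v⁻ ψ₁) rises | ++⁻ (v⁺ ψ₁) falls
    ... | rises₁ , rises₂ | falls₁ , falls₂ =
      λ ψ₁⇒ψ₂ → preserve ψ₂ rises₂ falls₂ x ∘ ψ₁⇒ψ₂ ∘ reflect ψ₁ falls₁ rises₁ x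
    preserve (□ ψ) rises falls x □ψ kxRv with back kxRv
    ... | y , xRy , refl = preserve ψ rises falls y (□ψ xRy)

    reflect : ∀ ψ → All (Falls V₁ V₂ k) (v⁺ ψ) → All (Rises V₁ V₂ k) (v⁻ ψ) →
              ∀ x → V₂ ⊨[ k x ] ψ → V₁ ⊨[ x ] ψ
    reflect (var p) (fall ∷ []) _ x = fall x
    reflect ⊥' _ _ x ()
    reflect (ψ₁ ∧' ψ₂) falls rises x with ++⁻ (v⁺ ψ₁) falls | ++⁻ (v⁻ ψ₁) rises
    ... | falls₁ , falls₂ | rises₁ , rises₂ =
      Product.map (reflect ψ₁ falls₁ rises₁ x) (reflect ψ₂ falls₂ rises₂ x)
    reflect (ψ₁ ∨' ψ₂) falls rises x with ++⁻ (v⁺ ψ₁) falls | ++⁻ (v⁻ ψ₁) rises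
    ... | falls₁ , falls₂ | rises₁ , rises₂ =
      Sum.map (reflect ψ₁ falls₁ rises₁ x) (reflect ψ₂ falls₂ rises₂ x)
    reflect (¬' ψ) falls rises x ¬ψ = ¬ψ ∘ preserve ψ rises falls x
    reflect (ψ₁ ⇒ ψ₂) falls rises x with ++⁻ (v⁻ ψ₁) falls | ++⁻ (v⁺ ψ₁) rises
    ... | falls₁ , falls₂ | rises₁ , rises₂ =
      λ ψ₁⇒ψ₂ → reflect ψ₂ falls₂ rises₂ x ∘ ψ₁⇒ψ₂ ∘ preserve ψ₁ rises₁ falls₁ x
    reflect (□ ψ) falls rises x □ψ xRy = reflect ψ falls rises _ (□ψ (forth xRy))

R-refl : ∀ x → R x x
R-refl r = r-r
R-refl a = a-a
R-refl b = b-b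

id-pm : IsPMorphism id
id-pm = record { forth = id ; back = λ xRv → _ , xRv , refl }

swap : W → W
swap r = r
swap a = b
swap b = a

swap-pm : IsPMorphism swap
swap-pm = record { forth = forth ; back = back }
  where
    forth : ∀ {x y} → R x y → R (swap x) (swap y)
    forth r-r = r-r
    forth r-a = r-b
    forth r-b = r-a
    forth a-a = b-b
    forth b-b = a-a
    back : ∀ {x v} → R (swap x) v → ∃[ y ] (R x y × swap y ≡ v)
    back {r} r-r = r , r-r , refl
    back {r} r-a = b , r-b , refl
    back {r} r-b = a , r-a , refl
    back {a} b-b = a , a-a , refl
    back {b} a-a = b , b-b , refl

-- The p-morphism of the frame onto the subframe generated by w, sending r to w.
toCone : W → W → W
toCone r x = x
toCone a _ = a
toCone b _ = b

toCone-root : ∀ w → toCone w r ≡ w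
toCone-root r = refl
toCone-root a = refl
toCone-root b = refl

toCone-pm : ∀ w → IsPMorphism (toCone w)
toCone-pm r = id-pm
toCone-pm a = record { forth = λ _ → a-a ; back = λ { a-a → _ , R-refl _ , refl } }
toCone-pm b = record { forth = λ _ → b-b ; back = λ { b-b → _ , R-refl _ , refl } }

vars : Fm → List ℕ
vars φ = v⁺ φ ++ v⁻ φ

infix 4 _≈[_]_

_≈[_]_ : Valuation → List ℕ → Valuation → Set
U ≈[ Q ] V = ∀ {p} → p ∈ Q → ∀ x → U p x ≡ V p x

⊨-agree : ∀ ψ {U V x} → U ≈[ vars ψ ] V → U ⊨[ x ] ψ → V ⊨[ x ] ψ
⊨-agree ψ U≈V = preserve id-pm ψ
  (All.tabulate λ p∈ y → subst T (U≈V (∈-++⁺ˡ p∈) y))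
  (All.tabulate λ p∈ y → subst T (sym (U≈V (∈-++⁺ʳ (v⁺ ψ) p∈) y)))
  _

bools : List Bool
bools = true ∷ false ∷ []

∈-bools : ∀ x → x ∈ bools
∈-bools true  = here refl
∈-bools false = there (here refl)

tabulateW : Bool → Bool → Bool → W → Bool
tabulateW x y z r = x
tabulateW x y z a = y
tabulateW x y z b = z

predicatesW : List (W → Bool)
predicatesW = cartesianProductWith _$_ (cartesianProductWith tabulateW bools bools) bools

predicatesW-complete : ∀ (g : W → Bool) → ∃[ f ] (f ∈ predicatesW × ∀ x → f x ≡ g x)
predicatesW-complete g =
  tabulateW (g r) (g a) (g b) ,
  ∈-cartesianProductWith⁺ _$_
    (∈-cartesianProductWith⁺ tabulateW (∈-bools (g r)) (∈-bools (g a))) (∈-bools (g b)) ,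
  λ { r → refl ; a → refl ; b → refl }

infixl 6 _[_≔_]

_[_≔_] : Valuation → ℕ → (W → Bool) → Valuation
(U [ q ≔ f ]) p with p ≟ q
... | yes _ = f
... | no _  = U p

[≔]-≈ : ∀ {U V q Q f} → U ≈[ Q ] V → (∀ x → f x ≡ V q x) → U [ q ≔ f ] ≈[ q ∷ Q ] V
[≔]-≈ {q = q} U≈V f≈Vq {p} p∈ x with p ≟ q
... | yes refl = f≈Vq x
... | no p≢q   = U≈V (tail p≢q p∈) x

valuations : List ℕ → List Valuation
valuations []      = [ (λ _ _ → false) ]
valuations (q ∷ Q) = cartesianProductWith (λ f U → U [ q ≔ f ]) predicatesW (valuations Q)

valuations-complete : ∀ Q V → ∃[ U ] (U ∈ valuations Q × U ≈[ Q ] V)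
valuations-complete []      V = _ , here refl , λ ()
valuations-complete (q ∷ Q) V
  with U , U∈ , U≈V ← valuations-complete Q V
     | f , f∈ , f≈Vq ← predicatesW-complete (V q)
  = U [ q ≔ f ] , ∈-cartesianProductWith⁺ (λ f U → U [ q ≔ f ]) f∈ U∈ , [≔]-≈ U≈V f≈Vq

⊤' : Fm
⊤' = ¬' ⊥'

◇_ : Fm → Fm
◇ ψ = ¬' (□ (¬' ψ))

⋀ ⋁ : {A : Set} → List A → (A → Fm) → Fm
⋀ []       f = ⊤'
⋀ (x ∷ xs) f = f x ∧' ⋀ xs f
⋁ []       f = ⊥'
⋁ (x ∷ xs) f = f x ∨' ⋁ xs f

module _ {A : Set} {f : A → Fm} {V : Valuation} {w : W} where

  ⋀-intro : ∀ {xs} → (∀ {x} → x ∈ xs → V ⊨[ w ] f x) → V ⊨[ w ] ⋀ xs f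
  ⋀-intro {[]}     _ ()
  ⋀-intro {x ∷ xs} h = h (here refl) , ⋀-intro (h ∘ there)

  ⋀-elim : ∀ {xs x} → V ⊨[ w ] ⋀ xs f → x ∈ xs → V ⊨[ w ] f x
  ⋀-elim (fx , _)  (here refl) = fx
  ⋀-elim (_ , ⋀xs) (there x∈) = ⋀-elim ⋀xs x∈

  ⋁-intro : ∀ {xs x} → x ∈ xs → V ⊨[ w ] f x → V ⊨[ w ] ⋁ xs f
  ⋁-intro (here refl) fx = inj₁ fx
  ⋁-intro (there x∈)  fx = inj₂ (⋁-intro x∈ fx)

  ⋁-elim : ∀ {xs} → V ⊨[ w ] ⋁ xs f → ∃[ x ] (x ∈ xs × V ⊨[ w ] f x)
  ⋁-elim {x ∷ xs} (inj₁ fx) = x , here refl , fx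
  ⋁-elim {x ∷ xs} (inj₂ ⋁xs) with y , y∈ , fy ← ⋁-elim ⋁xs = y , there y∈ , fy

record Within (A⁺ A⁻ : ℕ → Set) (φ : Fm) : Set where
  constructor within
  field
    positive : All A⁺ (v⁺ φ)
    negative : All A⁻ (v⁻ φ)

module _ {A⁺ A⁻ : ℕ → Set} where

  within-var : ∀ {p} → A⁺ p → Within A⁺ A⁻ (var p)
  within-var A⁺p = within (A⁺p ∷ []) []

  within-¬var : ∀ {p} → A⁻ p → Within A⁺ A⁻ (¬' var p)
  within-¬var A⁻p = within [] (A⁻p ∷ [])

  within-∧ : ∀ {φ ψ} → Within A⁺ A⁻ φ → Within A⁺ A⁻ ψ → Within A⁺ A⁻ (φ ∧' ψ)
  within-∧ (within pos₁ neg₁) (within pos₂ neg₂) = within (++⁺ pos₁ pos₂) (++⁺ neg₁ neg₂)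

  within-∨ : ∀ {φ ψ} → Within A⁺ A⁻ φ → Within A⁺ A⁻ ψ → Within A⁺ A⁻ (φ ∨' ψ)
  within-∨ (within pos₁ neg₁) (within pos₂ neg₂) = within (++⁺ pos₁ pos₂) (++⁺ neg₁ neg₂)

  within-□ : ∀ {φ} → Within A⁺ A⁻ φ → Within A⁺ A⁻ (□ φ)
  within-□ (within pos neg) = within pos neg

  within-◇ : ∀ {φ} → Within A⁺ A⁻ φ → Within A⁺ A⁻ (◇ φ)
  within-◇ (within pos neg) = within pos neg

  within-⋀ : ∀ {A : Set} {xs : List A} {f} →
             (∀ {x} → x ∈ xs → Within A⁺ A⁻ (f x)) → Within A⁺ A⁻ (⋀ xs f)
  within-⋀ {xs = []}     _ = within [] []
  within-⋀ {xs = x ∷ xs} h = within-∧ (h (here refl)) (within-⋀ (h ∘ there))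

  within-⋁ : ∀ {A : Set} {xs : List A} {f} →
             (∀ {x} → x ∈ xs → Within A⁺ A⁻ (f x)) → Within A⁺ A⁻ (⋁ xs f)
  within-⋁ {xs = []}     _ = within [] []
  within-⋁ {xs = x ∷ xs} h = within-∨ (h (here refl)) (within-⋁ (h ∘ there))

-- At any point, ◇ □ Y says that some final successor satisfies Y; the last conjunct makes
-- X a and X b hold at distinct final points.
diagram : (W → Fm) → Fm
diagram X = X r ∧' ((◇ (□ X a)) ∧' ((◇ (□ X b)) ∧' (□ ((◇ (□ X a)) ∨' (◇ (□ X b))))))

within-diagram : ∀ {A⁺ A⁻ X} → (∀ x → Within A⁺ A⁻ (X x)) → Within A⁺ A⁻ (diagram X)
within-diagram X-within =
  within-∧ (X-within r) (within-∧ ◇□Xa (within-∧ ◇□Xb (within-□ (within-∨ ◇□Xa ◇□Xb))))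
  where
    ◇□Xa = within-◇ (within-□ (X-within a))
    ◇□Xb = within-◇ (within-□ (X-within b))

Realises : Valuation → W → (W → Fm) → Set
Realises V w X = ∃[ k ] (IsPMorphism k × k r ≡ w × ∀ x → V ⊨[ k x ] X x)

Final : W → Set
Final x = ∀ {y} → R x y → y ≡ x

a-final : Final a
a-final a-a = refl

b-final : Final b
b-final b-b = refl

◇-intro : ∀ {V ψ w u} → R w u → V ⊨[ u ] ψ → V ⊨[ w ] ◇ ψ
◇-intro wRu ψu □¬ψ = □¬ψ wRu ψu

module _ {V : Valuation} {ψ : Fm} where

  ◇□-image : ∀ {k x y} → IsPMorphism k → Final x → R y x → V ⊨[ k x ] ψ → V ⊨[ k y ] ◇ (□ ψ)
  ◇□-image {k} {x} pm final yRx ψkx = ◇-intro {ψ = □ ψ} (IsPMorphism.forth pm yRx) □ψ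
    where
      □ψ : V ⊨[ k x ] □ ψ
      □ψ kxRv with IsPMorphism.back pm kxRv
      ... | x' , xRx' , refl = subst (λ z → V ⊨[ k z ] ψ) (sym (final xRx')) ψkx

  ◇□-final : ∀ {x} → Final x → V ⊨[ x ] ◇ (□ ψ) → V ⊨[ x ] ψ
  ◇□-final {x} final ◇□ψ = decidable-stable (⊨? V x ψ) λ ¬ψ →
    ◇□ψ λ {y} xRy □ψ → ¬ψ (□ψ (subst (R y) (final xRy) (R-refl y)))

  ◇□-root : V ⊨[ r ] ◇ (□ ψ) → V ⊨[ a ] ψ ⊎ V ⊨[ b ] ψ
  ◇□-root ◇□ψ with ⊨? V a ψ | ⊨? V b ψ
  ... | yes ψa | _      = inj₁ ψa
  ... | no _   | yes ψb = inj₂ ψb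
  ... | no ¬ψa | no ¬ψb = ⊥-elim (◇□ψ λ
    { r-r □ψ → ¬ψa (□ψ r-a)
    ; r-a □ψ → ¬ψa (□ψ a-a)
    ; r-b □ψ → ¬ψb (□ψ b-b)
    })

matching₂ : {A B C D : Set} → A ⊎ B → C ⊎ D → A ⊎ C → B ⊎ D → (A × D) ⊎ (C × B)
matching₂ _          _          (inj₁ x) (inj₂ d) = inj₁ (x , d)
matching₂ _          (inj₁ c)   (inj₁ _) (inj₁ y) = inj₂ (c , y)
matching₂ _          (inj₂ d)   (inj₁ x) (inj₁ _) = inj₁ (x , d)
matching₂ _          _          (inj₂ c) (inj₁ y) = inj₂ (c , y)
matching₂ (inj₁ x)   _          (inj₂ _) (inj₂ d) = inj₁ (x , d)
matching₂ (inj₂ y)   _          (inj₂ c) (inj₂ _) = inj₂ (c , y)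

diagram-intro : ∀ {V X k} → IsPMorphism k → (∀ x → V ⊨[ k x ] X x) → V ⊨[ k r ] diagram X
diagram-intro {V} {X} {k} pm X⊨ = X⊨ r , ◇□Xa r-a , ◇□Xb r-b , ◇□Xa∨◇□Xb
  where
    ◇□Xa : ∀ {y} → R y a → V ⊨[ k y ] ◇ (□ X a)
    ◇□Xa yRa = ◇□-image {ψ = X a} pm a-final yRa (X⊨ a)
    ◇□Xb : ∀ {y} → R y b → V ⊨[ k y ] ◇ (□ X b)
    ◇□Xb yRb = ◇□-image {ψ = X b} pm b-final yRb (X⊨ b)
    ◇□Xa∨◇□Xb : V ⊨[ k r ] □ ((◇ (□ X a)) ∨' (◇ (□ X b)))
    ◇□Xa∨◇□Xb krRv with IsPMorphism.back pm krRv
    ... | _ , r-r , refl = inj₁ (◇□Xa r-a)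
    ... | _ , r-a , refl = inj₁ (◇□Xa a-a)
    ... | _ , r-b , refl = inj₂ (◇□Xb b-b)

diagram-elim : ∀ {V w X} → V ⊨[ w ] diagram X → Realises V w X
diagram-elim {w = r} {X} (Xr , ◇□Xa , ◇□Xb , □∨)
  with matching₂ (◇□-root {ψ = X a} ◇□Xa) (◇□-root {ψ = X b} ◇□Xb)
                 (Sum.map (◇□-final {ψ = X a} a-final) (◇□-final {ψ = X b} a-final) (□∨ r-a))
                 (Sum.map (◇□-final {ψ = X a} b-final) (◇□-final {ψ = X b} b-final) (□∨ r-b))
... | inj₁ (Xa-at-a , Xb-at-b) = id , id-pm , refl , λ { r → Xr ; a → Xa-at-a ; b → Xb-at-b }
... | inj₂ (Xb-at-a , Xa-at-b) = swap , swap-pm , refl , λ { r → Xr ; a → Xa-at-b ; b → Xb-at-a }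
diagram-elim {w = a} {X} (Xr , ◇□Xa , ◇□Xb , _) = toCone a , toCone-pm a , refl ,
  λ { r → Xr ; a → ◇□-final {ψ = X a} a-final ◇□Xa ; b → ◇□-final {ψ = X b} a-final ◇□Xb }
diagram-elim {w = b} {X} (Xr , ◇□Xa , ◇□Xb , _) = toCone b , toCone-pm b , refl ,
  λ { r → Xr ; a → ◇□-final {ψ = X a} b-final ◇□Xa ; b → ◇□-final {ψ = X b} b-final ◇□Xb }

⊨-diagram : ∀ {V w X} → V ⊨[ w ] diagram X ⇔ Realises V w X
⊨-diagram {X = X} =
  mk⇔ (diagram-elim {X = X}) λ { (k , pm , refl , X⊨) → diagram-intro {X = X} pm X⊨ }

module _ {A B : Set} where

  blend : Dec A → Dec B → Bool → Bool → Bool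
  blend (yes _) (yes _) u v = u
  blend (yes _) (no _)  u v = u ∨ v
  blend (no _)  (yes _) u v = u ∧ v
  blend (no _)  (no _)  u v = v

  u≤blend : ∀ A? B? {u v} → (¬ A → T u → T v) → T u → T (blend A? B? u v)
  u≤blend (yes _) (yes _)    _ tu = tu
  u≤blend (yes _) (no _)     _ tu = from T-∨ (inj₁ tu)
  u≤blend (no ¬A) (yes _) u⇒v tu = from T-∧ (tu , u⇒v ¬A tu)
  u≤blend (no ¬A) (no _)  u⇒v tu = u⇒v ¬A tu

  blend≤u : ∀ A? B? {u v} → (¬ B → T v → T u) → T (blend A? B? u v) → T u
  blend≤u (yes _) (yes _)    _ t = t
  blend≤u (yes _) (no ¬B) v⇒u t = Sum.[ id , v⇒u ¬B ] (to T-∨ t)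
  blend≤u (no _)  (yes _)    _ t = proj₁ (to T-∧ t)
  blend≤u (no _)  (no ¬B) v⇒u t = v⇒u ¬B t

  blend≤v : ∀ A? B? {u v} → ¬ A → T (blend A? B? u v) → T v
  blend≤v (yes x) _       ¬A = ⊥-elim (¬A x)
  blend≤v (no _)  (yes _) _ t = proj₂ (to T-∧ t)
  blend≤v (no _)  (no _)  _ t = t

  v≤blend : ∀ A? B? {u v} → ¬ B → T v → T (blend A? B? u v)
  v≤blend _       (yes y) ¬B = ⊥-elim (¬B y)
  v≤blend (yes _) (no _)  _ tv = from T-∨ (inj₂ tv)
  v≤blend (no _)  (no _)  _ tv = tv

module Interpolant (φ : Fm) (P⁺ P⁻ : List ℕ) where

  Allowed⁺ Allowed⁻ : ℕ → Set
  Allowed⁺ p = p ∈ v⁺ φ × p ∉ P⁺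
  Allowed⁻ p = p ∈ v⁻ φ × p ∉ P⁻

  Positive Negative : Valuation → W → ℕ → Set
  Positive U x p = p ∉ P⁺ × T (U p x)
  Negative U x p = p ∉ P⁻ × ¬ T (U p x)

  positive? : ∀ U x p → Dec (Positive U x p)
  negative? : ∀ U x p → Dec (Negative U x p)
  positive? U x p = p ∉? P⁺ ×-dec T? (U p x)
  negative? U x p = p ∉? P⁻ ×-dec ¬? (T? (U p x))

  positives negatives : Valuation → W → List ℕ
  positives U x = filter (positive? U x) (v⁺ φ)
  negatives U x = filter (negative? U x) (v⁻ φ)

  χ : Valuation → W → Fm
  χ U x = ⋀ (positives U x) var ∧' ⋀ (negatives U x) (λ p → ¬' var p)

  Covers : Valuation → W → Valuation → W → Set
  Covers U x V u = (∀ {p} → p ∈ v⁺ φ → p ∉ P⁺ → T (U p x) → T (V p u))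
                 × (∀ {p} → p ∈ v⁻ φ → p ∉ P⁻ → T (V p u) → T (U p x))

  ∈-positives : ∀ U x {p} → p ∈ positives U x ⇔ (p ∈ v⁺ φ × Positive U x p)
  ∈-positives U x =
    mk⇔ (∈-filter⁻ (positive? U x) {xs = v⁺ φ}) (uncurry (∈-filter⁺ (positive? U x)))

  ∈-negatives : ∀ U x {p} → p ∈ negatives U x ⇔ (p ∈ v⁻ φ × Negative U x p)
  ∈-negatives U x =
    mk⇔ (∈-filter⁻ (negative? U x) {xs = v⁻ φ}) (uncurry (∈-filter⁺ (negative? U x)))

  ⊨χ⇔Covers : ∀ U x {V u} → V ⊨[ u ] χ U x ⇔ Covers U x V u
  ⊨χ⇔Covers U x = mk⇔
    (λ (⊨pos , ⊨neg) →
        (λ p∈ p∉ Up → ⋀-elim {f = var} ⊨pos (from (∈-positives U x) (p∈ , p∉ , Up)))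
      , (λ {p} p∈ p∉ Vp → decidable-stable (T? (U p x)) λ ¬Up →
           ⋀-elim {f = λ p → ¬' var p} ⊨neg (from (∈-negatives U x) (p∈ , p∉ , ¬Up)) Vp))
    (λ (pos , neg) →
        ⋀-intro (λ p∈ → let p∈φ , p∉ , Up = to (∈-positives U x) p∈ in pos p∈φ p∉ Up)
      , ⋀-intro (λ p∈ → let p∈φ , p∉ , ¬Up = to (∈-negatives U x) p∈ in ¬Up ∘ neg p∈φ p∉))

  within-χ : ∀ U x → Within Allowed⁺ Allowed⁻ (χ U x)
  within-χ U x = within-∧
    (within-⋀ λ p∈ → let p∈φ , p∉ , _ = to (∈-positives U x) p∈ in within-var (p∈φ , p∉))
    (within-⋀ λ p∈ → let p∈φ , p∉ , _ = to (∈-negatives U x) p∈ in within-¬var (p∈φ , p∉))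

  transfer : ∀ {ψ U V w} → φ ⊨ ψ → Within (_∉ P⁺) (_∉ P⁻) ψ →
             U ⊨[ r ] φ → Realises V w (χ U) → V ⊨[ w ] ψ
  transfer {ψ} {U} {V} φ⊨ψ (within ψ⁺ ψ⁻) Uφ (k , pm , refl , Vχ) =
    preserve pm ψ (All.map M↗V ψ⁺) (All.map M↘V ψ⁻) r
      (φ⊨ψ M r (preserve id-pm φ (All.tabulate U↗M) (All.tabulate U↘M) r Uφ))
    where
      -- M is chosen so that φ transfers from U to M (by Covers) and ψ from M to V along k
      -- (as ψ avoids P⁺ and P⁻).
      M : Valuation
      M p x = blend (p ∈? P⁺) (p ∈? P⁻) (U p x) (V p (k x))
      covers : ∀ x → Covers U x V (k x)
      covers x = to (⊨χ⇔Covers U x) (Vχ x)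
      U↗M : ∀ {p} → p ∈ v⁺ φ → Rises U M id p
      U↗M {p} p∈ x = u≤blend (p ∈? P⁺) (p ∈? P⁻) (proj₁ (covers x) p∈)
      U↘M : ∀ {p} → p ∈ v⁻ φ → Falls U M id p
      U↘M {p} p∈ x = blend≤u (p ∈? P⁺) (p ∈? P⁻) (proj₂ (covers x) p∈)
      M↗V : ∀ {p} → p ∉ P⁺ → Rises M V k p
      M↗V {p} p∉ x = blend≤v (p ∈? P⁺) (p ∈? P⁻) p∉
      M↘V : ∀ {p} → p ∉ P⁻ → Falls M V k p
      M↘V {p} p∉ x = v≤blend (p ∈? P⁺) (p ∈? P⁻) p∉

  models : List Valuation
  models = filter (λ U → ⊨? U r φ) (valuations (vars φ))

  ∈-models : ∀ {U} → U ∈ models ⇔ (U ∈ valuations (vars φ) × U ⊨[ r ] φ)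
  ∈-models = mk⇔ (∈-filter⁻ (λ U → ⊨? U r φ) {xs = valuations (vars φ)})
                 (uncurry (∈-filter⁺ (λ U → ⊨? U r φ)))

  θ : Fm
  θ = ⋁ models (diagram ∘ χ)

  within-θ : Within Allowed⁺ Allowed⁻ θ
  within-θ = within-⋁ λ {U} _ → within-diagram (within-χ U)

  φ⊨θ : φ ⊨ θ
  φ⊨θ V w Vφ with U , U∈ , U≈V∘toCone ← valuations-complete (vars φ) (λ p x → V p (toCone w x)) =
    ⋁-intro {f = diagram ∘ χ} (from ∈-models (U∈ , Uφ))
      (from (⊨-diagram {X = χ U})
        (toCone w , toCone-pm w , toCone-root w , λ x → from (⊨χ⇔Covers U x) (covers x)))
    where
      Uφ : U ⊨[ r ] φ
      Uφ = ⊨-agree φ (λ p∈ x → sym (U≈V∘toCone p∈ x))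
             (reflect (toCone-pm w) φ (All.tabulate λ _ _ → id) (All.tabulate λ _ _ → id) r
               (subst (V ⊨[_] φ) (sym (toCone-root w)) Vφ))
      covers : ∀ x → Covers U x V (toCone w x)
      covers x = (λ p∈ _ → subst T (U≈V∘toCone (∈-++⁺ˡ p∈) x))
               , (λ p∈ _ → subst T (sym (U≈V∘toCone (∈-++⁺ʳ (v⁺ φ) p∈) x)))

  θ⊨ψ : ∀ {ψ} → φ ⊨ ψ → Within (_∉ P⁺) (_∉ P⁻) ψ → θ ⊨ ψ
  θ⊨ψ φ⊨ψ ψ-within V w Vθ with U , U∈ , Vdiagram ← ⋁-elim {f = diagram ∘ χ} Vθ =
    transfer φ⊨ψ ψ-within (proj₂ (to ∈-models U∈))
      (to (⊨-diagram {X = χ U}) Vdiagram)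

uniformLyndon : UniformLyndon GV⊢
uniformLyndon φ P⁺ P⁻ =
  θ , from (⊢⇔⊨ {φ} {θ}) φ⊨θ ,
  (λ _ → All.lookup (Within.positive within-θ)) ,
  (λ _ → All.lookup (Within.negative within-θ)) ,
  λ ψ ⊢φ⇒ψ ψ⁺ ψ⁻ → from (⊢⇔⊨ {θ} {ψ})
    (θ⊨ψ {ψ} (to (⊢⇔⊨ {φ} {ψ}) ⊢φ⇒ψ) (within (All.tabulate (ψ⁺ _)) (All.tabulate (ψ⁻ _))))
  where open Interpolant φ P⁺ P⁻

infixl 5 _∖_

_∖_ : List ℕ → List ℕ → List ℕ
xs ∖ ys = filter (_∉? ys) xs

∉-∖ : ∀ {p xs ys} → p ∈ ys → p ∉ xs ∖ ys
∉-∖ {xs = xs} {ys} p∈ys p∈ = proj₂ (∈-filter⁻ (_∉? ys) {xs = xs} p∈) p∈ys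

∈-∖-complement : ∀ {p xs ys} → p ∈ xs → p ∉ xs ∖ ys → p ∈ ys
∈-∖-complement {p} {ys = ys} p∈xs p∉ =
  decidable-stable (p ∈? ys) (λ p∉ys → p∉ (∈-filter⁺ (_∉? ys) p∈xs p∉ys))

uniformLyndon⇒lyndon : ∀ L → UniformLyndon L → Lyndon L
uniformLyndon⇒lyndon L uniform φ ψ ⊢φ⇒ψ
  with ρ , ⊢φ⇒ρ , ρ⁺ , ρ⁻ , ρ-strongest ← uniform φ (v⁺ φ ∖ v⁺ ψ) (v⁻ φ ∖ v⁻ ψ) =
  ρ , shared ρ⁺ , shared ρ⁻ , ⊢φ⇒ρ ,
  ρ-strongest ψ ⊢φ⇒ψ (λ _ → ∉-∖ {xs = v⁺ φ}) (λ _ → ∉-∖ {xs = v⁻ φ})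
  where
    shared : ∀ {zs xs ys} → (∀ p → p ∈ zs → p ∈ xs × p ∉ xs ∖ ys) → ∀ p → p ∈ zs → p ∈ xs × p ∈ ys
    shared h p p∈zs with p∈xs , p∉ ← h p p∈zs = p∈xs , ∈-∖-complement p∈xs p∉

theorem7p1 : UniformLyndon GV⊢ × Lyndon GV⊢
theorem7p1 = uniformLyndon , uniformLyndon⇒lyndon GV⊢ uniformLyndon
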